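{- Let $\langle A,\rightarrow,\top\rangle$ be a BCI-algebra with induced order $\preceq$, and let $\mathbb{A}=\{[a,b]: a,b\in A,\ a\preceq b\}$. If there are $a,b\in A$ with $a\neq b$ and $a\rightarrow b=\top$, then for every interval $D\in\mathbb{A}$ there is no interval representation $F$ of $\rightarrow$ such that $\langle \mathbb{A},F,D\rangle$ is a BCI-algebra.
   Context: A BCI-algebra is a structure $\langle B,\rightarrow,\top\rangle$, with $\rightarrow$ a binary operation on $B$ and $\top\in B$, such that for all $x,y,z\in B$: (C1) $(y\rightarrow z)\rightarrow((z\rightarrow x)\rightarrow(y\rightarrow x))=\top$; (C2) $x\rightarrow((x\rightarrow y)\rightarrow y)=\top$; (C3) $x\rightarrow x=\top$; (C4) if $x\rightarrow y=\top$ and $y\rightarrow x=\top$ then $x=y$. Its induced relation is $x\preceq y$ iff $x\rightarrow y=\top$ (a partial order). For $X=[a,b]\in\mathbb{A}$ write $\underline{X}=a$, $\overline{X}=b$, and say $x\in X$ if $\underline X\preceq x\preceq\overline X$. A binary operation $F:\mathbb{A}\times\mathbb{A}\to\mathbb{A}$ is an interval representation of $\rightarrow$ if for all $X,Y\in\mathbb{A}$ and all $x\in X$, $y\in Y$ one has $x\rightarrow y\in F(X,Y)$. -}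

module Defs where

open import Level using (Level; _⊔_)
open import Relation.Binary.PropositionalEquality using (_≡_)
open import Data.Product using (_×_)

record IsBCI {a ℓ : Level} (B : Set a) (_≈_ : B → B → Set ℓ)
             (_⇒_ : B → B → B) (⊤ : B) : Set (a ⊔ ℓ) where
  field
    C1 : ∀ x y z → ((y ⇒ z) ⇒ ((z ⇒ x) ⇒ (y ⇒ x))) ≈ ⊤
    C2 : ∀ x y → (x ⇒ ((x ⇒ y) ⇒ y)) ≈ ⊤
    C3 : ∀ x → (x ⇒ x) ≈ ⊤
    C4 : ∀ x y → (x ⇒ y) ≈ ⊤ → (y ⇒ x) ≈ ⊤ → x ≈ y

record BCIAlgebra (a : Level) : Set (Level.suc a) where
  field
    Carrier : Set a
    _⇒_     : Carrier → Carrier → Carrier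
    ⊤       : Carrier
    isBCI   : IsBCI Carrier _≡_ _⇒_ ⊤

module _ {a : Level} (𝔸 : BCIAlgebra a) where
  open BCIAlgebra 𝔸

  _≼_ : Carrier → Carrier → Set a
  x ≼ y = (x ⇒ y) ≡ ⊤

  record Interval : Set a where
    constructor [_,_]⟨_⟩
    field
      lo  : Carrier
      hi  : Carrier
      lo≼hi : lo ≼ hi

  open Interval public

  _≐_ : Interval → Interval → Set a
  X ≐ Y = (lo X ≡ lo Y) × (hi X ≡ hi Y)

  _∈I_ : Carrier → Interval → Set a
  x ∈I X = (lo X ≼ x) × (x ≼ hi X)

  IsIntervalRep : (Interval → Interval → Interval) → Set a
  IsIntervalRep F = ∀ X Y x y → x ∈I X → y ∈I Y → (x ⇒ y) ∈I F X Y

module Submission where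

-- Suppose F were an interval representation of ⇒ making
-- ⟨𝔸, F, D⟩ a BCI-algebra, and let a ≠ b with a ≼ b.  Put I = [a, b] and
-- P = [a, a].
--   * By C3 for the interval algebra, F(I, I) = D; since b ∈ I and a ∈ I,
--     the representation property gives u := b ⇒ a ∈ D.
--   * In every BCI-algebra the unit is a left identity: ⊤ ⇒ x = x.  Applied
--     to the interval algebra (whose unit is D) this yields F(D, P) = P, so
--     u ⇒ a ∈ P, i.e. (b ⇒ a) ⇒ a = a.
--   * Then C2, b ⇒ ((b ⇒ a) ⇒ a) = ⊤, reads b ⇒ a = ⊤, and antisymmetry (C4)
--     forces a = b — a contradiction.

open import Defs
open import Level using (Level)
open import Relation.Binary.PropositionalEquality using (_≡_; refl; subst; cong)
open import Relation.Nullary using (¬_)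
open import Data.Product using (Σ; _×_; _,_; proj₁; proj₂)
open import Axiom.UniquenessOfIdentityProofs.WithK using (uip)

module BCILaws {a : Level} {B : Set a} {_⇒_ : B → B → B} {⊤ : B}
               (isBCI : IsBCI B _≡_ _⇒_ ⊤) where
  open IsBCI isBCI

  x≼⊤⇒x : ∀ x → (x ⇒ (⊤ ⇒ x)) ≡ ⊤
  x≼⊤⇒x x = subst (λ t → (x ⇒ (t ⇒ x)) ≡ ⊤) (C3 x) (C2 x x)

  ⊤≼x⇒x≡⊤ : ∀ x → (⊤ ⇒ x) ≡ ⊤ → x ≡ ⊤
  ⊤≼x⇒x≡⊤ x ⊤≼x = C4 x ⊤ (subst (λ t → (x ⇒ t) ≡ ⊤) ⊤≼x (x≼⊤⇒x x)) ⊤≼x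

  -- The unit is a left identity: ⊤ ⇒ x = x.  (⊤ ⇒ x ≼ x because
  -- ⊤ ≼ (⊤ ⇒ x) ⇒ x by C2, and x ≼ ⊤ ⇒ x by the first law.)
  ⊤-identityˡ : ∀ x → (⊤ ⇒ x) ≡ x
  ⊤-identityˡ x = C4 (⊤ ⇒ x) x (⊤≼x⇒x≡⊤ _ (C2 ⊤ x)) (x≼⊤⇒x x)

module _ {ℓ : Level} (𝔸 : BCIAlgebra ℓ) where
  open BCIAlgebra 𝔸

  -- Intervals with the same endpoints are equal: the order witnesses are
  -- proofs of an equation, hence unique.
  ≐⇒≡ : {X Y : Interval 𝔸} → _≐_ 𝔸 X Y → X ≡ Y
  ≐⇒≡ {[ l , h ]⟨ p ⟩} {[ .l , .h ]⟨ q ⟩} (refl , refl) = cong [ l , h ]⟨_⟩ (uip p q)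

  ≡⇒≐ : {X Y : Interval 𝔸} → X ≡ Y → _≐_ 𝔸 X Y
  ≡⇒≐ refl = refl , refl

  -- Hence a BCI-structure on intervals up to _≐_ is one up to _≡_, so the
  -- general BCI laws apply to it.
  ≐-BCI⇒≡-BCI : ∀ {F D} → IsBCI (Interval 𝔸) (_≐_ 𝔸) F D →
                IsBCI (Interval 𝔸) _≡_ F D
  ≐-BCI⇒≡-BCI isI = record
    { C1 = λ x y z → ≐⇒≡ (IsBCI.C1 isI x y z)
    ; C2 = λ x y → ≐⇒≡ (IsBCI.C2 isI x y)
    ; C3 = λ x → ≐⇒≡ (IsBCI.C3 isI x)
    ; C4 = λ x y p q → ≐⇒≡ (IsBCI.C4 isI x y (≡⇒≐ p) (≡⇒≐ q))
    }

theorem1 : {ℓ : Level} (𝔸 : BCIAlgebra ℓ) →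
    Σ (BCIAlgebra.Carrier 𝔸) (λ a → Σ (BCIAlgebra.Carrier 𝔸) (λ b →
    (¬ (a ≡ b)) × (BCIAlgebra._⇒_ 𝔸 a b ≡ BCIAlgebra.⊤ 𝔸))) →
    (D : Interval 𝔸) (F : Interval 𝔸 → Interval 𝔸 → Interval 𝔸) →
    IsIntervalRep 𝔸 F →
    ¬ IsBCI (Interval 𝔸) (_≐_ 𝔸) F D
theorem1 𝔸 (a , b , a≢b , a≼b) D F rep isI = a≢b (C4 a b a≼b b≼a)
  where
  open BCIAlgebra 𝔸
  open IsBCI isBCI
  isIntervalBCI : IsBCI (Interval 𝔸) _≡_ F D
  isIntervalBCI = ≐-BCI⇒≡-BCI 𝔸 isI

  _∈_ : Carrier → Interval 𝔸 → Set _
  _∈_ = _∈I_ 𝔸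

  I P : Interval 𝔸
  I = [ a , b ]⟨ a≼b ⟩
  P = [ a , a ]⟨ C3 a ⟩

  -- b ⇒ a lies in F(I, I), which is D by C3 for intervals.
  b⇒a∈D : (b ⇒ a) ∈ D
  b⇒a∈D = subst ((b ⇒ a) ∈_) (IsBCI.C3 isIntervalBCI I)
                (rep I I b a (a≼b , C3 b) (C3 a , a≼b))

  -- (b ⇒ a) ⇒ a lies in F(D, P), which is P as D is the unit of intervals.
  [b⇒a]⇒a∈P : ((b ⇒ a) ⇒ a) ∈ P
  [b⇒a]⇒a∈P = subst (((b ⇒ a) ⇒ a) ∈_) (BCILaws.⊤-identityˡ isIntervalBCI P)
                    (rep D P (b ⇒ a) a b⇒a∈D (C3 a , C3 a))

  -- membership in [a, a] pins the element down by antisymmetry.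
  [b⇒a]⇒a≡a : ((b ⇒ a) ⇒ a) ≡ a
  [b⇒a]⇒a≡a = C4 _ a (proj₂ [b⇒a]⇒a∈P) (proj₁ [b⇒a]⇒a∈P)

  b≼a : (b ⇒ a) ≡ ⊤
  b≼a = subst (λ t → (b ⇒ t) ≡ ⊤) [b⇒a]⇒a≡a (C2 b a)
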